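{- Let $n\ge 2$ targets $\mathcal T=\{1,\dots,n\}$ be given with travel times $c(u,v)>0$ ($u\ne v$) satisfying the triangle inequality. Let $\mathcal W=(v_1,\dots,v_{k+1})$ be a closed walk with $k\ge n$ visits, and write $k=pn+q$ with integers $p\ge 1$, $0\le q\le n-1$. Then there exist a target $d$ and indices $i<j$ of the periodic extension $(v_i)_{i\ge1}$ of $\mathcal W$ with $v_i=v_j=d$, $v_l\ne d$ for $i<l<j$, and $j-i\ge n+\lceil q/p\rceil$ (a closed subwalk with terminus $d$ having at least $n+\lceil q/p\rceil$ visits). Consequently, $\mathcal R^*(k)\ge \mathcal R^*(n+\lceil q/p\rceil)$.
   Context: Targets $\mathcal T=\{1,\dots,n\}$, $n\ge 2$; travel times $c(u,v)>0$ for distinct $u,v\in\mathcal T$ (set $c(u,u)=0$), satisfying $c(u,v)+c(v,w)\ge c(u,w)$ for all $u,v,w\in\mathcal T$. For an integer $k\ge n$, a closed walk with $k$ visits is a sequence $\mathcal W=(v_1,\dots,v_{k+1})$ of targets with $v_{k+1}=v_1$, $v_i\ne v_{i+1}$ for $1\le i\le k$, and every target appearing among $v_1,\dots,v_k$. The walk is repeated forever: extend it to the infinite periodic sequence $(v_i)_{i\ge 1}$ with $v_{i+k}=v_i$, where moving from $v_i$ to $v_{i+1}$ takes time $c(v_i,v_{i+1})$. For a target $d$, the revisit time $RT(d,\mathcal W)$ is the maximum, over all pairs of indices $i<j$ with $v_i=v_j=d$ and $v_l\ne d$ for $i<l<j$, of $\sum_{l=i}^{j-1}c(v_l,v_{l+1})$.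 The revisit time of the walk is $\mathcal R(\mathcal W)=\max_{d\in\mathcal T}RT(d,\mathcal W)$, and $\mathcal R^*(k)$ is the minimum of $\mathcal R(\mathcal W)$ over all closed walks with $k$ visits (with the convention $\mathcal R^*(k)=+\infty$ if no such walk exists).
   Formalization: The travel times $c(u,v)$ take rational values. -}

module Defs where

open import Data.Nat as ℕ using (ℕ; zero; suc; _∸_; NonZero)
open import Data.Nat.DivMod using (_/_)
open import Data.Fin using (Fin)
open import Data.Rational as ℚ using (ℚ; 0ℚ)
open import Data.Product using (Σ; ∃; _×_)
open import Relation.Binary.PropositionalEquality using (_≡_; _≢_)
open import Relation.Nullary using (¬_)

⌈_/_⌉ : (q p : ℕ) → .{{NonZero p}} → ℕ
⌈ q / p ⌉ = (q ℕ.+ (p ∸ 1)) / p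

-- Travel-time matrix on targets Fin n (0-based indexing of the targets 1..n).
Cost : ℕ → Set
Cost n = Fin n → Fin n → ℚ

record ValidCost (n : ℕ) (c : Cost n) : Set where
  field
    diag     : ∀ u → c u u ≡ 0ℚ
    positive : ∀ u v → u ≢ v → 0ℚ ℚ.< c u v
    triangle : ∀ u v w → c u w ℚ.≤ c u v ℚ.+ c v w

-- A closed walk with k visits, represented by its periodic extension
-- (v_{i+1} in the paper is  seq i  here; indices are 0-based).
record ClosedWalk (n k : ℕ) : Set where
  field
    seq      : ℕ → Fin n
    periodic : ∀ i → seq (i ℕ.+ k) ≡ seq i
    noStay   : ∀ i → seq i ≢ seq (suc i)
    covers   : ∀ (t : Fin n) → ∃ λ i → i ℕ.< k × seq i ≡ t
open ClosedWalk public

segCost : ∀ {n} → Cost n → (ℕ → Fin n) → ℕ → ℕ → ℚ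
segCost c v i zero = 0ℚ
segCost c v i (suc len) = c (v i) (v (suc i)) ℚ.+ segCost c v (suc i) len

ReturnPair : ∀ {n k} → ClosedWalk n k → Fin n → ℕ → ℕ → Set
ReturnPair W d i j =
  i ℕ.< j × seq W i ≡ d × seq W j ≡ d × (∀ l → i ℕ.< l → l ℕ.< j → seq W l ≢ d)

HasRevisitTime : ∀ {n k} → Cost n → ClosedWalk n k → ℚ → Set
HasRevisitTime c W r =
  (∀ d i j → ReturnPair W d i j → segCost c (seq W) i (j ∸ i) ℚ.≤ r)
  × (∃ λ d → ∃ λ i → ∃ λ j → ReturnPair W d i j × segCost c (seq W) i (j ∸ i) ≡ r)

IsOptRevisit : ∀ {n} → Cost n → ℕ → ℚ → Set
IsOptRevisit {n} c k r =
  (∃ λ (W : ClosedWalk n k) → HasRevisitTime c W r)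
  × (∀ (W : ClosedWalk n k) r′ → HasRevisitTime c W r′ → r ℚ.≤ r′)

{-# OPTIONS --safe #-}
-- If every return to a target took at most M = n + ⌈q/p⌉ - 1 steps then, as M p < k, each target would
-- be visited at least p + 1 times per period of k visits, and counting visits would give k ≥ n (p + 1) > k;
-- so some return is long. For the revisit times, take an optimal walk with k visits and a long return in
-- it, enlarged if necessary to a return that passes every target. Its closed subwalk is a tour with at
-- least n + ⌈q/p⌉ visits and cost at most R*(k). Deleting repeated visits does not increase the cost
-- (triangle inequality) and shrinks it to exactly n + ⌈q/p⌉ visits, and the revisit time of a closed walk
-- is at most the cost of one period.
module Submission where

open import Defs
open import Algebra.Bundles using (CommutativeMonoid)
open import Data.Fin as F using (Fin; zero; suc)
open import Data.Fin.Properties using (injective⇒≤)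
open import Data.List using (List; []; _∷_; _∷ʳ_; length; lookup; upTo; allFin; applyUpTo)
open import Data.List.Properties using (length-applyUpTo; applyUpTo-∷ʳ)
open import Data.List.Membership.Propositional using (_∈_; _∉_)
open import Data.List.Membership.Propositional.Properties
  using (∈-lookup; ∈-allFin; ∈-upTo⁺; ∈-applyUpTo⁺; ∈-applyUpTo⁻; ∈-++⁻)
import Data.List.Relation.Unary.All as All
open import Data.List.Relation.Unary.Any using (here; there)
open import Data.List.Relation.Unary.Linked using (Linked; _∷_)
import Data.List.Relation.Unary.Linked.Properties as Linked
open import Data.List.Relation.Binary.Sublist.Propositional using (_⊆_; []; _∷_; ⊆-refl; ⊆-trans)
import Data.List.Relation.Binary.Sublist.Propositional as Sublist
open import Data.List.Relation.Unary.All.Properties using (¬Any⇒All¬)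
open import Data.List.Relation.Binary.Sublist.Propositional.Properties using (Any-resp-⊆; ++⁺)
open import Data.List.Relation.Unary.Unique.Propositional using (Unique; []; _∷_)
open import Data.Nat
  using (ℕ; zero; suc; pred; _+_; _*_; _∸_; _≤_; _<_; _≰_; z≤n; s≤s; NonZero; _<?_; _≤?_)
open import Data.Nat.DivMod
  using (_%_; _/_; m≡m%n+[m/n]*n; m%n<n; m/n*n≤m; m<n⇒m%n≡m; n%n≡0; [m+n]%n≡m%n; [m+kn]%n≡m%n)
open import Data.Nat.Properties
open import Data.Nat.Tactic.RingSolver using (solve-∀)
open import Data.Product using (∃; _×_; _,_; proj₁; proj₂)
open import Data.Rational as ℚ using (ℚ; 0ℚ)
import Data.Rational.Properties as ℚP
open import Data.Sum using (_⊎_; inj₁; inj₂)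
open import Data.Vec.Functional using (Vector)
open import Function using (_∘_; case_of_)
open import Function.Definitions using (Injective)
open import Relation.Binary.Bundles using (TotalOrder; DecTotalOrder)
open import Relation.Binary.Definitions using (DecidableEquality; tri<; tri≈; tri>)
open import Relation.Binary.PropositionalEquality
  using (_≡_; _≢_; refl; sym; trans; cong; cong₂; subst; subst₂; module ≡-Reasoning)
open import Relation.Nullary using (¬_; Dec; yes; no; contradiction)
open import Relation.Unary using (Pred; Decidable)
open import Algebra.Properties.CommutativeMonoid.Sum +-0-commutativeMonoid
  using (sum; ∑-distrib-+; sum-replicate-zero)

least-witness : ∀ {p} {P : Pred ℕ p} → Decidable P → ∀ {m} → P m →
                ∃ λ j → j ≤ m × P j × (∀ {l} → l < j → ¬ P l)
least-witness P? {zero} pm = 0 , z≤n , pm , λ ()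
least-witness P? {suc m} pm with P? 0
... | yes p0 = 0 , z≤n , p0 , λ ()
... | no ¬p0 with least-witness (P? ∘ suc) pm
...   | j , j≤m , pj , below =
  suc j , s≤s j≤m , pj , λ { {zero} _ → ¬p0 ; {suc l} (s≤s l<j) → below l<j }

[m+o]∸[n+o]≡m∸n : ∀ m n o → (m + o) ∸ (n + o) ≡ m ∸ n
[m+o]∸[n+o]≡m∸n m n o = trans (cong₂ _∸_ (+-comm m o) (+-comm n o)) ([m+n]∸[m+o]≡n∸o o m n)

module WindowSum {c ℓ} (M : CommutativeMonoid c ℓ) where
  open CommutativeMonoid M
    using (Carrier; _≈_; _∙_; ε; setoid; ∙-cong; ∙-congˡ; assoc; comm; identityˡ)
    renaming (refl to ≈-refl)
  open import Relation.Binary.Reasoning.Setoid setoid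

  windowSum : (ℕ → Carrier) → ℕ → ℕ → Carrier
  windowSum h a zero      = ε
  windowSum h a (suc len) = h a ∙ windowSum h (suc a) len

  windowSum-+ : ∀ h a x y → windowSum h a (x + y) ≈ windowSum h a x ∙ windowSum h (a + x) y
  windowSum-+ h a zero y = begin
    windowSum h a y             ≡⟨ cong (λ b → windowSum h b y) (+-identityʳ a) ⟨
    windowSum h (a + 0) y       ≈⟨ identityˡ _ ⟨
    ε ∙ windowSum h (a + 0) y   ∎
  windowSum-+ h a (suc x) y = begin
    h a ∙ windowSum h (suc a) (x + y)
      ≈⟨ ∙-congˡ (windowSum-+ h (suc a) x y) ⟩
    h a ∙ (windowSum h (suc a) x ∙ windowSum h (suc a + x) y)
      ≈⟨ assoc _ _ _ ⟨
    windowSum h a (suc x) ∙ windowSum h (suc (a + x)) y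
      ≡⟨ cong (λ b → windowSum h a (suc x) ∙ windowSum h b y) (+-suc a x) ⟨
    windowSum h a (suc x) ∙ windowSum h (a + suc x) y ∎

  windowSum-shift : ∀ {h D} → (∀ l → h (l + D) ≈ h l) →
                    ∀ a len → windowSum h (a + D) len ≈ windowSum h a len
  windowSum-shift per a zero      = ≈-refl
  windowSum-shift per a (suc len) = ∙-cong (per a) (windowSum-shift per (suc a) len)

  windowSum-rotate : ∀ {h K a} → (∀ l → h (l + K) ≈ h l) → a ≤ K →
                     windowSum h a K ≈ windowSum h 0 K
  windowSum-rotate {h} {K} {a} per a≤K = begin
    windowSum h a K                           ≡⟨ cong (windowSum h a) K≡b+a ⟩
    windowSum h a (b + a)                     ≈⟨ windowSum-+ h a b a ⟩
    windowSum h a b ∙ windowSum h (a + b) a   ≡⟨ cong (λ e → windowSum h a b ∙ windowSum h e a) a+b≡K ⟩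
    windowSum h a b ∙ windowSum h (0 + K) a   ≈⟨ ∙-congˡ (windowSum-shift per 0 a) ⟩
    windowSum h a b ∙ windowSum h 0 a         ≈⟨ comm _ _ ⟩
    windowSum h 0 a ∙ windowSum h a b         ≈⟨ windowSum-+ h 0 a b ⟨
    windowSum h 0 (a + b)                     ≡⟨ cong (windowSum h 0) a+b≡K ⟩
    windowSum h 0 K                           ∎
    where
    b : ℕ
    b = K ∸ a
    a+b≡K : a + b ≡ K
    a+b≡K = m+[n∸m]≡n a≤K
    K≡b+a : K ≡ b + a
    K≡b+a = trans (sym a+b≡K) (+-comm a b)

module ℕΣ = WindowSum +-0-commutativeMonoid
module ℚΣ = WindowSum ℚP.+-0-commutativeMonoid

δ : ∀ {n} → Fin n → Fin n → ℕ
δ zero    zero    = 1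
δ zero    (suc _) = 0
δ (suc _) zero    = 0
δ (suc x) (suc y) = δ x y

δ-diag : ∀ {n} (x : Fin n) → δ x x ≡ 1
δ-diag zero    = refl
δ-diag (suc x) = δ-diag x

∑-δ : ∀ {n} (x : Fin n) → sum (δ x) ≡ 1
∑-δ {suc n} zero    = cong suc (sum-replicate-zero n)
∑-δ {suc n} (suc x) = ∑-δ x

∑-≥ : ∀ {n b} (f : Vector ℕ n) → (∀ i → b ≤ f i) → n * b ≤ sum f
∑-≥ {zero}  f b≤f = z≤n
∑-≥ {suc n} f b≤f = +-mono-≤ (b≤f zero) (∑-≥ (f ∘ suc) (b≤f ∘ suc))

lookup-injective : ∀ {a} {A : Set a} {xs : List A} → Unique xs → Injective _≡_ _≡_ (lookup xs)
lookup-injective (x∉xs ∷ u) {zero}  {zero}  _  = refl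
lookup-injective (x∉xs ∷ u) {zero}  {suc j} eq = contradiction eq (All.lookup x∉xs (∈-lookup j))
lookup-injective (x∉xs ∷ u) {suc i} {zero}  eq = contradiction (sym eq) (All.lookup x∉xs (∈-lookup i))
lookup-injective (x∉xs ∷ u) {suc i} {suc j} eq = cong suc (lookup-injective u eq)

Unique⇒length≤ : ∀ {n} {xs : List (Fin n)} → Unique xs → length xs ≤ n
Unique⇒length≤ u = injective⇒≤ (lookup-injective u)

segCost-windowSum : ∀ {n} (c : Cost n) v i len →
                    segCost c v i len ≡ ℚΣ.windowSum (λ l → c (v l) (v (suc l))) i len
segCost-windowSum c v i zero      = refl
segCost-windowSum c v i (suc len) = cong (c (v i) (v (suc i)) ℚ.+_) (segCost-windowSum c v (suc i) len)

pathCost : ∀ {n} → Cost n → List (Fin n) → ℚ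
pathCost c []           = 0ℚ
pathCost c (x ∷ [])     = 0ℚ
pathCost c (x ∷ y ∷ ys) = c x y ℚ.+ pathCost c (y ∷ ys)

module _ {n} (c : Cost n) where

  segCost-∘suc : ∀ v i len → segCost c (v ∘ suc) i len ≡ segCost c v (suc i) len
  segCost-∘suc v i zero      = refl
  segCost-∘suc v i (suc len) = cong (c (v (suc i)) (v (suc (suc i))) ℚ.+_) (segCost-∘suc v (suc i) len)

  segCost-translate : ∀ v s i len → segCost c (λ l → v (l + s)) i len ≡ segCost c v (i + s) len
  segCost-translate v s i zero      = refl
  segCost-translate v s i (suc len) = cong (c (v (i + s)) (v (suc i + s)) ℚ.+_) (segCost-translate v s (suc i) len)

  segCost-cong : ∀ {g h len} → (∀ {l} → l ≤ len → g l ≡ h l) → segCost c g 0 len ≡ segCost c h 0 len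
  segCost-cong {len = zero}            g≗h = refl
  segCost-cong {g} {h} {len = suc len} g≗h = cong₂ ℚ._+_ (cong₂ c (g≗h z≤n) (g≗h (s≤s z≤n))) (begin
    segCost c g 1 len          ≡⟨ segCost-∘suc g 0 len ⟨
    segCost c (g ∘ suc) 0 len  ≡⟨ segCost-cong (g≗h ∘ s≤s) ⟩
    segCost c (h ∘ suc) 0 len  ≡⟨ segCost-∘suc h 0 len ⟩
    segCost c h 1 len          ∎)
    where open ≡-Reasoning

  segCost-applyUpTo : ∀ g len → segCost c g 0 len ≡ pathCost c (applyUpTo g (suc len))
  segCost-applyUpTo g zero      = refl
  segCost-applyUpTo g (suc len) = cong (c (g 0) (g 1) ℚ.+_)
    (trans (sym (segCost-∘suc g 0 len)) (segCost-applyUpTo (g ∘ suc) len))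

module _ {n} {c : Cost n} (valid : ValidCost n c) where
  open ValidCost valid

  cost-nonneg : ∀ u w → 0ℚ ℚ.≤ c u w
  cost-nonneg u w with u F.≟ w
  ... | yes refl = ℚP.≤-reflexive (sym (diag u))
  ... | no u≢w   = ℚP.<⇒≤ (positive u w u≢w)

  segCost-nonneg : ∀ v i len → 0ℚ ℚ.≤ segCost c v i len
  segCost-nonneg v i zero      = ℚP.≤-refl
  segCost-nonneg v i (suc len) = ℚP.≤-trans (ℚP.≤-reflexive (sym (ℚP.+-identityʳ 0ℚ)))
                                   (ℚP.+-mono-≤ (cost-nonneg _ _) (segCost-nonneg v (suc i) len))

  segCost-mono : ∀ v i {x y} → x ≤ y → segCost c v i x ℚ.≤ segCost c v i y
  segCost-mono v i {zero}  {y}     _         = segCost-nonneg v i y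
  segCost-mono v i {suc x} {suc y} (s≤s x≤y) = ℚP.+-monoʳ-≤ (c (v i) (v (suc i))) (segCost-mono v (suc i) x≤y)

  pathCost-detour : ∀ a b zs → pathCost c (a ∷ zs) ℚ.≤ c a b ℚ.+ pathCost c (b ∷ zs)
  pathCost-detour a b []       = ℚP.≤-trans (cost-nonneg a b) (ℚP.≤-reflexive (sym (ℚP.+-identityʳ _)))
  pathCost-detour a b (z ∷ zs) = begin
    c a z ℚ.+ pathCost c (z ∷ zs)               ≤⟨ ℚP.+-monoˡ-≤ (pathCost c (z ∷ zs)) (triangle a b z) ⟩
    (c a b ℚ.+ c b z) ℚ.+ pathCost c (z ∷ zs)   ≡⟨ ℚP.+-assoc (c a b) (c b z) _ ⟩
    c a b ℚ.+ (c b z ℚ.+ pathCost c (z ∷ zs))   ∎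
    where open ℚP.≤-Reasoning

  pathCost-⊆ : ∀ a {xs ys} → xs ⊆ ys → pathCost c (a ∷ xs) ℚ.≤ pathCost c (a ∷ ys)
  pathCost-⊆ a []                 = ℚP.≤-refl
  pathCost-⊆ a {ys = y ∷ ys} (y Sublist.∷ʳ τ) = ℚP.≤-trans (pathCost-⊆ a τ) (pathCost-detour a y ys)
  pathCost-⊆ a {x ∷ _} (refl ∷ τ) = ℚP.+-monoʳ-≤ (c a x) (pathCost-⊆ x τ)

lookupOr : ∀ {a} {A : Set a} → A → List A → ℕ → A
lookupOr d []       _       = d
lookupOr d (x ∷ xs) zero    = x
lookupOr d (x ∷ xs) (suc m) = lookupOr d xs m

module _ {a} {A : Set a} where

  lookupOr-length : ∀ (d : A) xs → lookupOr d xs (length xs) ≡ d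
  lookupOr-length d []       = refl
  lookupOr-length d (x ∷ xs) = lookupOr-length d xs

  lookupOr-∈ : ∀ {d y : A} xs → y ∈ xs → ∃ λ m → m < length xs × lookupOr d xs m ≡ y
  lookupOr-∈ (x ∷ xs) (here y≡x) = 0 , s≤s z≤n , sym y≡x
  lookupOr-∈ (x ∷ xs) (there y∈xs) with lookupOr-∈ xs y∈xs
  ... | m , m<len , eq = suc m , s≤s m<len , eq

  lookupOr-linked : ∀ {r} {R : A → A → Set r} {d} xs → Linked R (xs ∷ʳ d) →
                    ∀ {m} → m < length xs → R (lookupOr d xs m) (lookupOr d xs (suc m))
  lookupOr-linked (x ∷ [])     (r ∷ _)      {zero}  _         = r
  lookupOr-linked (x ∷ y ∷ xs) (r ∷ _)      {zero}  _         = r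
  lookupOr-linked (x ∷ [])     _            {suc m} (s≤s ())
  lookupOr-linked (x ∷ y ∷ xs) (_ ∷ linked) {suc m} (s≤s m<l) = lookupOr-linked (y ∷ xs) linked m<l

segCost-lookupOr : ∀ {n} (c : Cost n) d xs → segCost c (lookupOr d xs) 0 (length xs) ≡ pathCost c (xs ∷ʳ d)
segCost-lookupOr c d []           = refl
segCost-lookupOr c d (x ∷ [])     = refl
segCost-lookupOr c d (x ∷ y ∷ xs) = cong (c x y ℚ.+_)
  (trans (sym (segCost-∘suc c (lookupOr d (x ∷ y ∷ xs)) 0 (length (y ∷ xs)))) (segCost-lookupOr c d (y ∷ xs)))

module _ {n K : ℕ} .{{_ : NonZero K}} (f : ℕ → Fin n) (closes : f K ≡ f 0)
         (steps : ∀ {m} → m < K → f m ≢ f (suc m)) (visits : ∀ y → ∃ λ m → m < K × f m ≡ y) where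

  private
    f-% : ∀ {m} → m ≤ K → f (m % K) ≡ f m
    f-% m≤K with m≤n⇒m<n∨m≡n m≤K
    ... | inj₁ m<K  = cong f (m<n⇒m%n≡m m<K)
    ... | inj₂ refl = trans (cong f (n%n≡0 K)) (sym closes)

    f-%-suc : ∀ i → f (suc i % K) ≡ f (suc (i % K))
    f-%-suc i = trans (cong (λ e → f (suc e % K)) (m≡m%n+[m/n]*n i K))
                      (trans (cong f ([m+kn]%n≡m%n (suc (i % K)) (i / K) K)) (f-% (m%n<n i K)))

  periodicWalk : ClosedWalk n K
  periodicWalk = record
    { seq      = λ i → f (i % K)
    ; periodic = λ i → cong f ([m+n]%n≡m%n i K)
    ; noStay   = λ i → subst (f (i % K) ≢_) (sym (f-%-suc i)) (steps (m%n<n i K))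
    ; covers   = λ y → let m , m<K , fm≡y = visits y in m , m<K , trans (f-% (<⇒≤ m<K)) fm≡y
    }

  periodicWalk-segCost : ∀ c → segCost c (seq periodicWalk) 0 K ≡ segCost c f 0 K
  periodicWalk-segCost c = segCost-cong c f-%

module _ {a} {A : Set a} (_≟_ : DecidableEquality A) where
  open import Data.List.Membership.DecPropositional _≟_ using (_∈?_)

  dropFirstRepeat : List A → List A
  dropFirstRepeat []       = []
  dropFirstRepeat (x ∷ xs) with x ∈? xs
  ... | yes _ = xs
  ... | no  _ = x ∷ dropFirstRepeat xs

  dropFirstRepeat-⊆ : ∀ xs → dropFirstRepeat xs ⊆ xs
  dropFirstRepeat-⊆ []       = []
  dropFirstRepeat-⊆ (x ∷ xs) with x ∈? xs
  ... | yes _ = x Sublist.∷ʳ ⊆-refl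
  ... | no  _ = refl ∷ dropFirstRepeat-⊆ xs

  ∈-dropFirstRepeat : ∀ {y} xs → y ∈ xs → y ∈ dropFirstRepeat xs
  ∈-dropFirstRepeat (x ∷ xs) y∈ with x ∈? xs | y∈
  ... | yes x∈xs | here refl    = x∈xs
  ... | yes _    | there y∈xs   = y∈xs
  ... | no  _    | here y≡x     = here y≡x
  ... | no  _    | there y∈xs   = there (∈-dropFirstRepeat xs y∈xs)

  dropFirstRepeat-length : ∀ xs → Unique xs ⊎ suc (length (dropFirstRepeat xs)) ≡ length xs
  dropFirstRepeat-length []       = inj₁ []
  dropFirstRepeat-length (x ∷ xs) with x ∈? xs
  ... | yes _   = inj₂ refl
  ... | no x∉xs with dropFirstRepeat-length xs
  ...   | inj₁ unique  = inj₁ (¬Any⇒All¬ xs x∉xs ∷ unique)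
  ...   | inj₂ shorter = inj₂ (cong suc shorter)

  dropFirstRepeat-linked : ∀ {x e} xs → x ∉ xs → Linked _≢_ ((x ∷ xs) ∷ʳ e) →
                           Linked _≢_ ((x ∷ dropFirstRepeat xs) ∷ʳ e)
  dropFirstRepeat-linked []       _   linked = linked
  dropFirstRepeat-linked (u ∷ us) x∉ linked with u ∈? us
  dropFirstRepeat-linked (u ∷ w ∷ ws) x∉ (_ ∷ _ ∷ linked) | yes _ = (x∉ ∘ there ∘ here) ∷ linked
  dropFirstRepeat-linked (u ∷ us)     x∉ (x≢u ∷ linked)   | no u∉us =
    x≢u ∷ dropFirstRepeat-linked us u∉us linked

record IsTour {n} (x : Fin n) (U : List (Fin n)) : Set where
  field
    avoids : x ∉ U
    linked : Linked _≢_ ((x ∷ U) ∷ʳ x)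
    spans  : ∀ y → y ∈ x ∷ U
open IsTour

-- Deleting the first visit that is repeated later keeps consecutive visits distinct, and such a visit
-- exists as long as the tour is longer than the number of targets.
shrinkTour : ∀ {n x U N} → IsTour {n} x U → n ≤ N → N ≤ suc (length U) →
             ∃ λ U′ → U′ ⊆ U × IsTour x U′ × suc (length U′) ≡ N
shrinkTour {x = x} {U} {N} T n≤N N≤ = go (suc (length U) ∸ N) T ⊆-refl (sym (m∸n+n≡m N≤))
  where
  go : ∀ e {V} → IsTour x V → V ⊆ U → suc (length V) ≡ e + N →
       ∃ λ U′ → U′ ⊆ U × IsTour x U′ × suc (length U′) ≡ N
  go zero    {V} T V⊆U len = V , V⊆U , T , len
  go (suc e) {V} T V⊆U len with dropFirstRepeat-length F._≟_ V
  ... | inj₁ unique  = contradiction (≤-trans (Unique⇒length≤ (¬Any⇒All¬ V (avoids T) ∷ unique)) n≤N)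
                                     (subst (_≰ N) (sym len) (<⇒≱ (s≤s (m≤n+m N e))))
  ... | inj₂ shorter = go e T′ (⊆-trans (dropFirstRepeat-⊆ F._≟_ V) V⊆U) (trans shorter (suc-injective len))
    where
    T′ : IsTour x (dropFirstRepeat F._≟_ V)
    T′ = record
      { avoids = avoids T ∘ Any-resp-⊆ (dropFirstRepeat-⊆ F._≟_ V)
      ; linked = dropFirstRepeat-linked F._≟_ V (avoids T) (linked T)
      ; spans  = λ y → case spans T y of λ where
          (here y≡x)  → here y≡x
          (there y∈V) → there (∈-dropFirstRepeat F._≟_ V y∈V)
      }

module _ {n x U} (T : IsTour {n} x U) where

  private
    visits : ∀ y → ∃ λ m → m < suc (length U) × lookupOr x (x ∷ U) m ≡ y
    visits y = lookupOr-∈ (x ∷ U) (spans T y)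

  -- One period reads x ∷ U and then falls off the list onto the default x, which closes the tour.
  tourWalk : ClosedWalk n (suc (length U))
  tourWalk = periodicWalk (lookupOr x (x ∷ U)) (lookupOr-length x U) (lookupOr-linked (x ∷ U) (linked T)) visits

  tourWalk-segCost : ∀ c → segCost c (seq tourWalk) 0 (suc (length U)) ≡ pathCost c ((x ∷ U) ∷ʳ x)
  tourWalk-segCost c = trans
    (periodicWalk-segCost (lookupOr x (x ∷ U)) (lookupOr-length x U) (lookupOr-linked (x ∷ U) (linked T)) visits c)
    (segCost-lookupOr c x (x ∷ U))

module Walk {n k : ℕ} .{{_ : NonZero k}} (W : ClosedWalk n k) where

  private
    v : ℕ → Fin n
    v = seq W

  periodic-* : ∀ i m → v (i + m * k) ≡ v i
  periodic-* i zero    = cong v (+-identityʳ i)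
  periodic-* i (suc m) = begin
    v (i + (k + m * k))   ≡⟨ cong v (trans (cong (i +_) (+-comm k (m * k))) (sym (+-assoc i (m * k) k))) ⟩
    v (i + m * k + k)     ≡⟨ periodic W (i + m * k) ⟩
    v (i + m * k)         ≡⟨ periodic-* i m ⟩
    v i                   ∎
    where open ≡-Reasoning

  returnPair-+ : ∀ {d i j} m → ReturnPair W d i j → ReturnPair W d (i + m * k) (j + m * k)
  returnPair-+ {d} {i} {j} m (i<j , vi≡d , vj≡d , between) =
    +-monoˡ-< D i<j , trans (periodic-* i m) vi≡d , trans (periodic-* j m) vj≡d , between′
    where
    D : ℕ
    D = m * k
    between′ : ∀ l → i + D < l → l < j + D → v l ≢ d
    between′ l i+D<l l<j+D vl≡d = between (l ∸ D) i<l∸D l∸D<j v[l∸D]≡d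
      where
      D≤l : D ≤ l
      D≤l = ≤-trans (m≤n+m D i) (<⇒≤ i+D<l)
      i<l∸D : i < l ∸ D
      i<l∸D = m+n≤o⇒m≤o∸n (suc i) i+D<l
      l∸D<j : l ∸ D < j
      l∸D<j = subst (l ∸ D <_) (m+n∸n≡m j D) (∸-monoˡ-< l<j+D D≤l)
      v[l∸D]≡d : v (l ∸ D) ≡ d
      v[l∸D]≡d = trans (sym (periodic-* (l ∸ D) m)) (trans (cong v (m∸n+n≡m D≤l)) vl≡d)

  returnPair-unique : ∀ {d i j j′} → ReturnPair W d i j → ReturnPair W d i j′ → j ≡ j′
  returnPair-unique (i<j , _ , vj , between) (i<j′ , _ , vj′ , between′) with <-cmp _ _
  ... | tri< j<j′ _ _ = contradiction vj (between′ _ i<j j<j′)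
  ... | tri≈ _ j≡j′ _ = j≡j′
  ... | tri> _ _ j′<j = contradiction vj′ (between _ i<j′ j′<j)

  private
    1+i+[k-1]≡i+k : ∀ i → suc i + pred k ≡ i + k
    1+i+[k-1]≡i+k i = trans (sym (+-suc i (pred k))) (cong (i +_) (suc-pred k))

  nextVisit : ∀ i → ∃ λ j → ReturnPair W (v i) i j × j ≤ i + k
  nextVisit i with least-witness (λ l → v (suc i + l) F.≟ v i) (trans (cong v (1+i+[k-1]≡i+k i)) (periodic W i))
  ... | l , l≤ , hit , miss = suc i + l , (s≤s (m≤m+n i l) , refl , hit , between) , bound
    where
    between : ∀ l′ → i < l′ → l′ < suc i + l → v l′ ≢ v i
    between l′ i<l′ l′<1+i+l = miss offset<l ∘ subst (λ e → v e ≡ v i) (sym (m+[n∸m]≡n i<l′))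
      where
      offset<l : l′ ∸ suc i < l
      offset<l = subst (l′ ∸ suc i <_) (m+n∸m≡n (suc i) l) (∸-monoˡ-< l′<1+i+l i<l′)
    bound : suc i + l ≤ i + k
    bound = subst (suc i + l ≤_) (1+i+[k-1]≡i+k i) (+-monoʳ-≤ (suc i) l≤)

  next : ℕ → ℕ
  next i = proj₁ (nextVisit i)

  next-returnPair : ∀ i → ReturnPair W (v i) i (next i)
  next-returnPair i = proj₁ (proj₂ (nextVisit i))

  next-≤ : ∀ i → next i ≤ i + k
  next-≤ i = proj₂ (proj₂ (nextVisit i))

  returnPair-end : ∀ {d i j} → ReturnPair W d i j → j ≡ next (i % k) + i / k * k
  returnPair-end {d} {i} rp@(_ , vi≡d , _) = returnPair-unique rp translated
    where
    i≡ : i ≡ i % k + i / k * k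
    i≡ = m≡m%n+[m/n]*n i k
    v[i%k]≡d : v (i % k) ≡ d
    v[i%k]≡d = trans (sym (periodic-* (i % k) (i / k))) (trans (cong v (sym i≡)) vi≡d)
    translated : ReturnPair W d i (next (i % k) + i / k * k)
    translated = subst₂ (λ e s → ReturnPair W e s (next (i % k) + i / k * k)) v[i%k]≡d (sym i≡)
                        (returnPair-+ (i / k) (next-returnPair (i % k)))

  ShiftInvariant : ∀ {a} {A : Set a} → (ℕ → ℕ → A) → Set a
  ShiftInvariant w = ∀ i j m → w (i + m * k) (j + m * k) ≡ w i j

  returnPair-weight : ∀ {a} {A : Set a} {w : ℕ → ℕ → A} → ShiftInvariant w →
                      ∀ {d i j} → ReturnPair W d i j → w i j ≡ w (i % k) (next (i % k))
  returnPair-weight {w = w} invariant {i = i} rp =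
    trans (cong₂ w (m≡m%n+[m/n]*n i k) (returnPair-end rp)) (invariant (i % k) (next (i % k)) (i / k))

  module _ {a ℓ₁ ℓ₂} (O : TotalOrder a ℓ₁ ℓ₂) where
    open TotalOrder O using (Carrier) renaming (_≤_ to _≼_)
    open import Data.List.Extrema O using (argmax; f[xs]≤f[argmax])

    maximalReturnPair : (w : ℕ → ℕ → Carrier) → ShiftInvariant w →
      ∃ λ i → ∀ {d i′ j′} → ReturnPair W d i′ j′ → w i′ j′ ≼ w i (next i)
    maximalReturnPair w invariant = i₀ , longest
      where
      f : ℕ → Carrier
      f i = w i (next i)
      i₀ : ℕ
      i₀ = argmax f 0 (upTo k)
      longest : ∀ {d i′ j′} → ReturnPair W d i′ j′ → w i′ j′ ≼ f i₀
      longest {i′ = i′} rp = subst (_≼ f i₀) (sym (returnPair-weight {w = w} invariant rp))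
                                   (All.lookup (f[xs]≤f[argmax] {f = f} 0 (upTo k)) (∈-upTo⁺ (m%n<n i′ k)))

  occurrences : Fin n → ℕ → ℕ → ℕ
  occurrences d = ℕΣ.windowSum (λ l → δ (v l) d)

  ∑-occurrences : ∀ a len → sum (λ d → occurrences d a len) ≡ len
  ∑-occurrences a zero      = sum-replicate-zero n
  ∑-occurrences a (suc len) = trans (∑-distrib-+ (δ (v a)) (λ d → occurrences d (suc a) len))
                                    (cong₂ _+_ (∑-δ (v a)) (∑-occurrences (suc a) len))

  occurrences-here : ∀ {a d} → v a ≡ d → occurrences d a 1 ≡ 1
  occurrences-here {a} {d} va≡d = trans (+-identityʳ _) (trans (cong (λ e → δ e d) va≡d) (δ-diag d))

  occurrences-mono : ∀ d a {x y} → x ≤ y → occurrences d a x ≤ occurrences d a y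
  occurrences-mono d a {x} {y} x≤y = begin
    occurrences d a x                                          ≤⟨ m≤m+n _ _ ⟩
    occurrences d a x + occurrences d (a + x) (y ∸ x)          ≡⟨ ℕΣ.windowSum-+ _ a x (y ∸ x) ⟨
    occurrences d a (x + (y ∸ x))                              ≡⟨ cong (occurrences d a) (m+[n∸m]≡n x≤y) ⟩
    occurrences d a y                                          ∎
    where open ≤-Reasoning

  occurrences-rotate : ∀ d {a} → a ≤ k → occurrences d a k ≡ occurrences d 0 k
  occurrences-rotate d = ℕΣ.windowSum-rotate (λ l → cong (λ e → δ e d) (periodic W l))

  module _ {M : ℕ} (short : ∀ {d i j} → ReturnPair W d i j → j ∸ i ≤ M) where

    -- Consecutive visits to d are at most M apart, so t M + 1 steps from a visit contain t + 1 visits.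
    occurrences-≥ : ∀ {a d} → v a ≡ d → ∀ t → t < occurrences d a (suc (t * M))
    occurrences-≥ va≡d zero    = ≤-reflexive (sym (occurrences-here va≡d))
    occurrences-≥ {a} {d} va≡d (suc t) = begin-strict
      suc t
        <⟨ s≤s (occurrences-≥ vj≡d t) ⟩
      1 + occurrences d j (suc (t * M))
        ≡⟨ cong₂ _+_ (occurrences-here va≡d) (cong (λ e → occurrences d e (suc (t * M))) a+g≡j) ⟨
      occurrences d a 1 + occurrences d (a + g) (suc (t * M))
        ≤⟨ +-monoˡ-≤ _ (occurrences-mono d a 1≤g) ⟩
      occurrences d a g + occurrences d (a + g) (suc (t * M))
        ≡⟨ ℕΣ.windowSum-+ _ a g _ ⟨
      occurrences d a (g + suc (t * M))
        ≤⟨ occurrences-mono d a g+1+tM≤ ⟩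
      occurrences d a (suc (t * M) + M)
        ≡⟨ cong (occurrences d a ∘ suc) (+-comm (t * M) M) ⟩
      occurrences d a (suc (suc t * M))
        ∎
      where
      open ≤-Reasoning
      j : ℕ
      j = next a
      g : ℕ
      g = j ∸ a
      rp : ReturnPair W (v a) a j
      rp = next-returnPair a
      vj≡d : v j ≡ d
      vj≡d = trans (proj₁ (proj₂ (proj₂ rp))) va≡d
      a+g≡j : a + g ≡ j
      a+g≡j = m+[n∸m]≡n (<⇒≤ (proj₁ rp))
      1≤g : 1 ≤ g
      1≤g = m<n⇒0<n∸m (proj₁ rp)
      g+1+tM≤ : g + suc (t * M) ≤ suc (t * M) + M
      g+1+tM≤ = subst (_≤ suc (t * M) + M) (+-comm (suc (t * M)) g) (+-monoʳ-≤ (suc (t * M)) (short rp))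

    shortReturns⇒ : ∀ {p} → M * p < k → n * suc p ≤ k
    shortReturns⇒ {p} Mp<k = begin
      n * suc p                      ≤⟨ ∑-≥ (λ d → occurrences d 0 k) frequent ⟩
      sum (λ d → occurrences d 0 k)  ≡⟨ ∑-occurrences 0 k ⟩
      k                              ∎
      where
      open ≤-Reasoning
      frequent : ∀ d → suc p ≤ occurrences d 0 k
      frequent d with covers W d
      ... | o , o<k , vo≡d = begin
        suc p                           ≤⟨ occurrences-≥ vo≡d p ⟩
        occurrences d o (suc (p * M))   ≤⟨ occurrences-mono d o (subst (λ e → suc e ≤ k) (*-comm M p) Mp<k) ⟩
        occurrences d o k               ≡⟨ occurrences-rotate d (<⇒≤ o<k) ⟩
        occurrences d 0 k               ∎

  longReturnPair : ∀ {M p} → M * p < k → k < n * suc p →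
                   ∃ λ d → ∃ λ i → ∃ λ j → ReturnPair W d i j × M < j ∸ i
  longReturnPair {M} Mp<k k<n[1+p] = decide (M <? next i ∸ i)
    where
    maximal : ∃ λ i → ∀ {d i′ j′} → ReturnPair W d i′ j′ → j′ ∸ i′ ≤ next i ∸ i
    maximal = maximalReturnPair ≤-totalOrder (λ i j → j ∸ i) (λ i j m → [m+o]∸[n+o]≡m∸n j i (m * k))
    i : ℕ
    i = proj₁ maximal
    longest : ∀ {d i′ j′} → ReturnPair W d i′ j′ → j′ ∸ i′ ≤ next i ∸ i
    longest = proj₂ maximal
    decide : Dec (M < next i ∸ i) → ∃ λ d → ∃ λ i → ∃ λ j → ReturnPair W d i j × M < j ∸ i
    decide (yes long) = v i , i , next i , next-returnPair i , long
    decide (no ¬long) = contradiction (shortReturns⇒ (λ rp → ≤-trans (longest rp) (≮⇒≥ ¬long)) Mp<k)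
                                      (<⇒≱ k<n[1+p])

  Straddles : Fin n → ℕ → Set
  Straddles y I = ∃ λ s → ∃ λ t → ReturnPair W y s t × s < I × I ≤ t

  returnFrom : ∀ {a y} → v a ≡ y → Straddles y (suc a)
  returnFrom {a} va≡y = a , next a , subst (λ e → ReturnPair W e a (next a)) va≡y (next-returnPair a) ,
                        ≤-refl , proj₁ (next-returnPair a)

  straddle : ∀ {a y} → v a ≡ y → ∀ I → a < I → Straddles y I
  straddle va≡y (suc I) a<1+I with m≤n⇒m<n∨m≡n (≤-pred a<1+I)
  ... | inj₂ refl = returnFrom va≡y
  ... | inj₁ a<I with straddle va≡y I a<I
  ...   | s , t , rp@(_ , _ , vt≡y , _) , s<I , I≤t with m≤n⇒m<n∨m≡n I≤t
  ...     | inj₁ I<t  = s , t , rp , m≤n⇒m≤1+n s<I , I<t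
  ...     | inj₂ refl = returnFrom vt≡y

  Spans : ℕ → ℕ → Set
  Spans s t = ∀ y → ∃ λ l → s ≤ l × l ≤ t × v l ≡ y

  -- After shifting the pair by one period, every target y is visited before its start I; take the
  -- return to y that straddles I. If the one ending last ends within the shifted pair, that pair passes
  -- every target; otherwise this return contains the shifted pair and passes every target.
  spanningReturnPair : ∀ {d i j} → ReturnPair W d i j →
    ∃ λ x → ∃ λ s → ∃ λ t → ReturnPair W x s t × j ∸ i ≤ t ∸ s × Spans s t
  spanningReturnPair {d} {i} {j} rp = choose (end x ≤? J)
    where
    open import Data.List.Extrema ≤-totalOrder using (argmax; f[xs]≤f[argmax])
    I : ℕ
    I = i + 1 * k
    J : ℕ
    J = j + 1 * k
    J∸I≡j∸i : J ∸ I ≡ j ∸ i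
    J∸I≡j∸i = [m+o]∸[n+o]≡m∸n j i (1 * k)
    crossing : ∀ y → Straddles y I
    crossing y with covers W y
    ... | o , o<k , vo≡y = straddle vo≡y I (<-≤-trans o<k (≤-trans (m≤m+n k 0) (m≤n+m (1 * k) i)))
    start end : Fin n → ℕ
    start y = proj₁ (crossing y)
    end y = proj₁ (proj₂ (crossing y))
    crossingPair : ∀ y → ReturnPair W y (start y) (end y)
    crossingPair y = proj₁ (proj₂ (proj₂ (crossing y)))
    start<I : ∀ y → start y < I
    start<I y = proj₁ (proj₂ (proj₂ (proj₂ (crossing y))))
    I≤end : ∀ y → I ≤ end y
    I≤end y = proj₂ (proj₂ (proj₂ (proj₂ (crossing y))))
    end-visits : ∀ y → v (end y) ≡ y
    end-visits y = proj₁ (proj₂ (proj₂ (crossingPair y)))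
    x : Fin n
    x = argmax end d (allFin n)
    end≤ : ∀ y → end y ≤ end x
    end≤ y = All.lookup (f[xs]≤f[argmax] {f = end} d (allFin n)) (∈-allFin y)
    choose : Dec (end x ≤ J) → ∃ λ x → ∃ λ s → ∃ λ t → ReturnPair W x s t × j ∸ i ≤ t ∸ s × Spans s t
    choose (yes end≤J) = d , I , J , returnPair-+ 1 rp , ≤-reflexive (sym J∸I≡j∸i) ,
                         λ y → end y , I≤end y , ≤-trans (end≤ y) end≤J , end-visits y
    choose (no end≰J)  = x , start x , end x , crossingPair x ,
                         subst (_≤ end x ∸ start x) J∸I≡j∸i (∸-mono (<⇒≤ (≰⇒> end≰J)) (<⇒≤ (start<I x))) ,
                         λ y → end y , ≤-trans (<⇒≤ (start<I x)) (I≤end y) , end≤ y , end-visits y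

  module _ (c : Cost n) where

    returnCost-shiftInvariant : ShiftInvariant (λ i j → segCost c v i (j ∸ i))
    returnCost-shiftInvariant i j m = begin
      segCost c v (i + m * k) ((j + m * k) ∸ (i + m * k))
        ≡⟨ cong (segCost c v (i + m * k)) ([m+o]∸[n+o]≡m∸n j i (m * k)) ⟩
      segCost c v (i + m * k) (j ∸ i)
        ≡⟨ segCost-windowSum c v (i + m * k) (j ∸ i) ⟩
      ℚΣ.windowSum step (i + m * k) (j ∸ i)
        ≡⟨ ℚΣ.windowSum-shift (λ l → cong₂ c (periodic-* l m) (periodic-* (suc l) m)) i (j ∸ i) ⟩
      ℚΣ.windowSum step i (j ∸ i)
        ≡⟨ segCost-windowSum c v i (j ∸ i) ⟨
      segCost c v i (j ∸ i) ∎
      where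
      open ≡-Reasoning
      step : ℕ → ℚ
      step = λ l → c (v l) (v (suc l))

    revisitTime : ∃ λ r → HasRevisitTime c W r
    revisitTime = segCost c v i (next i ∸ i) , (λ _ _ _ → longest) , v i , i , next i , next-returnPair i , refl
      where
      maximal : ∃ λ i → ∀ {d i′ j′} → ReturnPair W d i′ j′ →
                  segCost c v i′ (j′ ∸ i′) ℚ.≤ segCost c v i (next i ∸ i)
      maximal = maximalReturnPair (DecTotalOrder.totalOrder ℚP.≤-decTotalOrder)
                                  (λ i j → segCost c v i (j ∸ i)) returnCost-shiftInvariant
      i : ℕ
      i = proj₁ maximal
      longest : ∀ {d i′ j′} → ReturnPair W d i′ j′ →
                segCost c v i′ (j′ ∸ i′) ℚ.≤ segCost c v i (next i ∸ i)
      longest = proj₂ maximal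

    returnCost≤periodCost : ValidCost n c → ∀ {d i j} → ReturnPair W d i j →
                            segCost c v i (j ∸ i) ℚ.≤ segCost c v 0 k
    returnCost≤periodCost valid {i = i} {j} rp = begin
      segCost c v i (j ∸ i)
        ≡⟨ returnPair-weight {w = λ i j → segCost c v i (j ∸ i)} returnCost-shiftInvariant rp ⟩
      segCost c v r (next r ∸ r)
        ≤⟨ segCost-mono valid v r next-gap≤k ⟩
      segCost c v r k
        ≡⟨ segCost-windowSum c v r k ⟩
      ℚΣ.windowSum step r k
        ≡⟨ ℚΣ.windowSum-rotate (λ l → cong₂ c (periodic W l) (periodic W (suc l))) (<⇒≤ (m%n<n i k)) ⟩
      ℚΣ.windowSum step 0 k
        ≡⟨ segCost-windowSum c v 0 k ⟨
      segCost c v 0 k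
        ∎
      where
      open ℚP.≤-Reasoning
      r : ℕ
      r = i % k
      step : ℕ → ℚ
      step = λ l → c (v l) (v (suc l))
      next-gap≤k : next r ∸ r ≤ k
      next-gap≤k = subst (next r ∸ r ≤_) (m+n∸m≡n r k) (∸-monoˡ-≤ r (next-≤ r))

    revisitTime≤periodCost : ValidCost n c → ∀ {r} → HasRevisitTime c W r → r ℚ.≤ segCost c v 0 k
    revisitTime≤periodCost valid (_ , _ , _ , _ , rp , cost≡r) =
      subst (ℚ._≤ _) cost≡r (returnCost≤periodCost valid rp)

  tourOfReturnPair : ∀ (c : Cost n) {x s t} → ReturnPair W x s t → Spans s t →
    ∃ λ U → IsTour x U × suc (length U) ≡ t ∸ s × pathCost c ((x ∷ U) ∷ʳ x) ≡ segCost c v s (t ∸ s)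
  tourOfReturnPair c {x} {s} {t} (s<t , vs≡x , vt≡x , between) spanning =
    U , tour , trans (cong suc (length-applyUpTo (g ∘ suc) L)) (sym t∸s≡1+L) , cost
    where
    g : ℕ → Fin n
    g l = v (l + s)
    L : ℕ
    L = t ∸ suc s
    t≡1+L+s : t ≡ suc L + s
    t≡1+L+s = trans (sym (m∸n+n≡m s<t)) (+-suc L s)
    t∸s≡1+L : t ∸ s ≡ suc L
    t∸s≡1+L = trans (cong (_∸ s) t≡1+L+s) (m+n∸n≡m (suc L) s)
    U : List (Fin n)
    U = applyUpTo (g ∘ suc) L
    closed : (x ∷ U) ∷ʳ x ≡ applyUpTo g (suc (t ∸ s))
    closed = begin
      x ∷ (U ∷ʳ x)
        ≡⟨ cong₂ (λ a b → a ∷ (U ∷ʳ b)) (sym vs≡x) (trans (sym vt≡x) (cong v t≡1+L+s)) ⟩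
      g 0 ∷ (U ∷ʳ g (suc L))
        ≡⟨ cong (g 0 ∷_) (applyUpTo-∷ʳ (g ∘ suc) L) ⟩
      applyUpTo g (suc (suc L))
        ≡⟨ cong (applyUpTo g ∘ suc) t∸s≡1+L ⟨
      applyUpTo g (suc (t ∸ s))
        ∎
      where open ≡-Reasoning
    dropLast : ∀ {y} → y ∈ (x ∷ U) ∷ʳ x → y ∈ x ∷ U
    dropLast y∈ with ∈-++⁻ (x ∷ U) y∈
    ... | inj₁ y∈x∷U      = y∈x∷U
    ... | inj₂ (here y≡x) = here y≡x
    spanned : ∀ y → y ∈ x ∷ U
    spanned y = let l , s≤l , l≤t , vl≡y = spanning y in
      dropLast (subst (y ∈_) (sym closed)
                      (subst (_∈ applyUpTo g (suc (t ∸ s))) (trans (cong v (m∸n+n≡m s≤l)) vl≡y)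
                             (∈-applyUpTo⁺ g (s≤s (∸-monoˡ-≤ s l≤t)))))
    tour : IsTour x U
    tour = record
      { avoids = λ x∈U → let l , l<L , x≡ = ∈-applyUpTo⁻ (g ∘ suc) x∈U in
                 between (suc l + s) (s≤s (m≤n+m s l))
                         (subst (suc l + s <_) (sym t≡1+L+s) (+-monoˡ-< s (s≤s l<L))) (sym x≡)
      ; linked = subst (Linked _≢_) (sym closed) (Linked.applyUpTo⁺₂ g (suc (t ∸ s)) (λ l → noStay W (l + s)))
      ; spans  = spanned
      }
    cost : pathCost c ((x ∷ U) ∷ʳ x) ≡ segCost c v s (t ∸ s)
    cost = trans (cong (pathCost c) closed)
                 (trans (sym (segCost-applyUpTo c g (t ∸ s))) (segCost-translate c v s 0 (t ∸ s)))

optimalRevisit≤tourCost : ∀ {n c x U r} → ValidCost n c → (T : IsTour x U) →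
  IsOptRevisit c (suc (length U)) r → r ℚ.≤ pathCost c ((x ∷ U) ∷ʳ x)
optimalRevisit≤tourCost {c = c} {x} {U} {r} valid T (_ , optimal) = viaRevisitTime (Walk.revisitTime (tourWalk T) c)
  where
  open ℚP.≤-Reasoning
  viaRevisitTime : ∃ (HasRevisitTime c (tourWalk T)) → r ℚ.≤ pathCost c ((x ∷ U) ∷ʳ x)
  viaRevisitTime (r′ , revisit) = begin
    r                                                  ≤⟨ optimal (tourWalk T) r′ revisit ⟩
    r′                                                 ≤⟨ Walk.revisitTime≤periodCost (tourWalk T) c valid revisit ⟩
    segCost c (seq (tourWalk T)) 0 (suc (length U))    ≡⟨ tourWalk-segCost T c ⟩
    pathCost c ((x ∷ U) ∷ʳ x)                          ∎

optimalRevisit-≤ : ∀ {n k N c r₁ r₂} .{{_ : NonZero k}} → ValidCost n c → n ≤ N → (W : ClosedWalk n k) →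
  (∃ λ d → ∃ λ i → ∃ λ j → ReturnPair W d i j × N ≤ j ∸ i) →
  HasRevisitTime c W r₁ → IsOptRevisit c N r₂ → r₂ ℚ.≤ r₁
optimalRevisit-≤ {c = c} {r₁} {r₂} valid n≤N W (_ , _ , _ , rp , N≤gap) (bounded , _) optimal =
  let x , s , t , rp′ , gap≤ , spanning = Walk.spanningReturnPair W rp
      U , T , length≡ , cost≡ = Walk.tourOfReturnPair W c rp′ spanning
      U′ , U′⊆U , T′ , length′≡ = shrinkTour T n≤N (≤-trans N≤gap (≤-trans gap≤ (≤-reflexive (sym length≡))))
  in begin
    r₂
      ≤⟨ optimalRevisit≤tourCost valid T′ (subst (λ K → IsOptRevisit c K r₂) (sym length′≡) optimal) ⟩
    pathCost c ((x ∷ U′) ∷ʳ x)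
      ≤⟨ pathCost-⊆ valid x (++⁺ U′⊆U ⊆-refl) ⟩
    pathCost c ((x ∷ U) ∷ʳ x)
      ≡⟨ cost≡ ⟩
    segCost c (seq W) s (t ∸ s)
      ≤⟨ bounded x s t rp′ ⟩
    r₁
      ∎
  where open ℚP.≤-Reasoning

ceiling-bounds : ∀ n₁ p₁ q → q < suc n₁ →
  (n₁ + ⌈ q / suc p₁ ⌉) * suc p₁ < suc p₁ * suc n₁ + q × suc p₁ * suc n₁ + q < suc n₁ * suc (suc p₁)
ceiling-bounds n₁ p₁ q q<1+n₁ = lower , upper
  where
  open ≤-Reasoning
  C : ℕ
  C = ⌈ q / suc p₁ ⌉
  regroup : ∀ a b c → suc (a * suc b + (c + b)) ≡ suc b * suc a + c
  regroup = solve-∀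
  regroup′ : ∀ a b → suc b * suc a + suc a ≡ suc a * suc (suc b)
  regroup′ = solve-∀
  lower : (n₁ + C) * suc p₁ < suc p₁ * suc n₁ + q
  lower = begin-strict
    (n₁ + C) * suc p₁             ≡⟨ *-distribʳ-+ (suc p₁) n₁ C ⟩
    n₁ * suc p₁ + C * suc p₁      ≤⟨ +-monoʳ-≤ (n₁ * suc p₁) (m/n*n≤m (q + p₁) (suc p₁)) ⟩
    n₁ * suc p₁ + (q + p₁)        <⟨ n<1+n _ ⟩
    suc (n₁ * suc p₁ + (q + p₁))  ≡⟨ regroup n₁ p₁ q ⟩
    suc p₁ * suc n₁ + q           ∎
  upper : suc p₁ * suc n₁ + q < suc n₁ * suc (suc p₁)
  upper = begin-strict
    suc p₁ * suc n₁ + q           <⟨ +-monoʳ-< (suc p₁ * suc n₁) q<1+n₁ ⟩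
    suc p₁ * suc n₁ + suc n₁      ≡⟨ regroup′ n₁ p₁ ⟩
    suc n₁ * suc (suc p₁)         ∎

lemma3 : (n : ℕ) → 2 ≤ n → (c : Cost n) → ValidCost n c →
    (k : ℕ) → n ≤ k → (p q : ℕ) → .{{_ : NonZero p}} → q < n → k ≡ p * n + q →
    ((W : ClosedWalk n k) →
      ∃ λ (d : Fin n) → ∃ λ i → ∃ λ j →
        ReturnPair W d i j × n + ⌈ q / p ⌉ ≤ j ∸ i)
    × (∀ r₁ r₂ → IsOptRevisit c k r₁ → IsOptRevisit c (n + ⌈ q / p ⌉) r₂ → r₂ ℚ.≤ r₁)
lemma3 n@(suc n₁) (s≤s (s≤s _)) c valid _ _ (suc p₁) q q<n refl =
  longReturn , λ _ _ ((W , revisit) , _) optimal →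
    optimalRevisit-≤ valid (m≤m+n n ⌈ q / suc p₁ ⌉) W (longReturn W) revisit optimal
  where
  longReturn : (W : ClosedWalk n (suc p₁ * n + q)) →
               ∃ λ d → ∃ λ i → ∃ λ j → ReturnPair W d i j × n + ⌈ q / suc p₁ ⌉ ≤ j ∸ i
  longReturn W = Walk.longReturnPair W (proj₁ (ceiling-bounds n₁ p₁ q q<n)) (proj₂ (ceiling-bounds n₁ p₁ q q<n))
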